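{- The meet-irreducible elements of the lattice $C(m,n)\sqcup\{ -1\}$ (the facets of $C(m,n)$) are exactly those good rectangular preorders on $\mathsf{Coll}(m,n)$ which have exactly $2$ equivalence classes.
   Context: Fix positive integers $m,n$. $\mathsf{Coll}(m,n)$ is the finite set of formal symbols $m_1,\dots,m_{m-1}$ and $l_1,\dots,l_{n-1}$. A preorder is a reflexive transitive relation $\le$; $x\equiv y$ means $x\le y$ and $y\le x$, $x<y$ means $x\le y$ but not $y\le x$, and $x,y$ are comparable if $x\le y$ or $y\le x$. Pairs $\{m_j,l_i\}$ are orthogonal; pairs $\{m_j,m_{j'}\}$ or $\{l_i,l_{i'}\}$ are parallel. Given a preorder, an orthogonal link between parallel $m_i,m_j$ is an $l_s$ with $m_i\le l_s\le m_j$ or $m_j\le l_s\le m_i$; a gap between $m_i,m_j$ is an $m_s$ with $s$ between $i$ and $j$ inclusive and $m_i<m_s$, $m_j<m_s$; links and gaps between $l_i,l_j$ are defined symmetrically. A preorder is a good rectangular preorder if (1) any two orthogonal collisions are comparable, and (2) two parallel collisions are comparable iff there is an orthogonal link between them or there is no gap between them. $C(m,n)$ is the set of good rectangular preorders ordered by refinement ($P\le Q$ iff $x\le_P y$ implies $x\le_Q y$), and $C(m,n)\sqcup\{ -1\}$ is $C(m,n)$ with a formal minimum $-1$ adjoined (it is a lattice). -}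

module Defs where

open import Data.Nat using (ℕ; _∸_)
open import Data.Fin using (Fin) renaming (_≤_ to _≤F_)
open import Data.Bool using (Bool; T)
open import Data.Maybe using (Maybe; just; nothing)
open import Data.Product using (_×_; ∃-syntax; _,_)
open import Data.Sum using (_⊎_)
open import Data.Empty using (⊥)
open import Data.Unit using (⊤)
open import Relation.Nullary using (¬_)
open import Relation.Binary.PropositionalEquality using (_≡_)
open import Function.Bundles using (_⇔_)

-- Coll(m,n): symbols m_1..m_{m-1} (mc j, j : Fin (m ∸ 1), mc j ↔ m_{j+1})
-- and l_1..l_{n-1} (lc i, i : Fin (n ∸ 1), lc i ↔ l_{i+1}).
data Coll (m n : ℕ) : Set where
  mc : Fin (m ∸ 1) → Coll m n
  lc : Fin (n ∸ 1) → Coll m n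

Rel : ℕ → ℕ → Set
Rel m n = Coll m n → Coll m n → Bool

module _ {m n : ℕ} (R : Rel m n) where

  _≼_ : Coll m n → Coll m n → Set
  x ≼ y = T (R x y)

  _≍_ : Coll m n → Coll m n → Set
  x ≍ y = x ≼ y × y ≼ x

  _≺_ : Coll m n → Coll m n → Set
  x ≺ y = x ≼ y × ¬ (y ≼ x)

  Comparable : Coll m n → Coll m n → Set
  Comparable x y = x ≼ y ⊎ y ≼ x

  IsPreorder : Set
  IsPreorder = (∀ x → x ≼ x) × (∀ x y z → x ≼ y → y ≼ z → x ≼ z)

  Between : ∀ {k} → Fin k → Fin k → Fin k → Set
  Between i s j = (i ≤F s × s ≤F j) ⊎ (j ≤F s × s ≤F i)

  LinkM : Fin (m ∸ 1) → Fin (m ∸ 1) → Set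
  LinkM i j = ∃[ s ] ((mc i ≼ lc s × lc s ≼ mc j) ⊎ (mc j ≼ lc s × lc s ≼ mc i))

  GapM : Fin (m ∸ 1) → Fin (m ∸ 1) → Set
  GapM i j = ∃[ s ] (Between i s j × mc i ≺ mc s × mc j ≺ mc s)

  LinkL : Fin (n ∸ 1) → Fin (n ∸ 1) → Set
  LinkL i j = ∃[ s ] ((lc i ≼ mc s × mc s ≼ lc j) ⊎ (lc j ≼ mc s × mc s ≼ lc i))

  GapL : Fin (n ∸ 1) → Fin (n ∸ 1) → Set
  GapL i j = ∃[ s ] (Between i s j × lc i ≺ lc s × lc j ≺ lc s)

  IsGood : Set
  IsGood = IsPreorder
         × (∀ j i → Comparable (mc j) (lc i))
         × (∀ i j → Comparable (mc i) (mc j) ⇔ (LinkM i j ⊎ ¬ GapM i j))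
         × (∀ i j → Comparable (lc i) (lc j) ⇔ (LinkL i j ⊎ ¬ GapL i j))

  TwoClasses : Set
  TwoClasses = ∃[ x ] ∃[ y ] (¬ (x ≍ y) × (∀ z → z ≍ x ⊎ z ≍ y))

_⊑_ : ∀ {m n} → Rel m n → Rel m n → Set
P ⊑ Q = ∀ x y → T (P x y) → T (Q x y)

-- The poset C(m,n) ⊔ {-1}: nothing = -1, just R = R (R must be good).
L : ℕ → ℕ → Set
L m n = Maybe (Rel m n)

InL : ∀ {m n} → L m n → Set
InL nothing  = ⊤
InL (just R) = IsGood R

_≤L_ : ∀ {m n} → L m n → L m n → Set
nothing ≤L _       = ⊤
just P  ≤L nothing = ⊥
just P  ≤L just Q  = P ⊑ Q

_≈L_ : ∀ {m n} → L m n → L m n → Set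
nothing ≈L nothing = ⊤
nothing ≈L just _  = ⊥
just _  ≈L nothing = ⊥
just P  ≈L just Q  = ∀ x y → P x y ≡ Q x y

IsMeet : ∀ {m n} → L m n → L m n → L m n → Set
IsMeet {m} {n} x a b =
  x ≤L a × x ≤L b × (∀ (z : L m n) → InL z → z ≤L a → z ≤L b → z ≤L x)

IsTop : ∀ {m n} → L m n → Set
IsTop {m} {n} x = ∀ (z : L m n) → InL z → z ≤L x

MeetIrreducible : ∀ {m n} → L m n → Set
MeetIrreducible {m} {n} x =
  InL x × ¬ IsTop x ×
  (∀ (a b : L m n) → InL a → InL b → IsMeet x a b → x ≈L a ⊎ x ≈L b)

-- A good preorder R with two classes b < t is meet-irreducible: a good preorder containing R either
-- keeps t above b, and then equals R, or puts t below b, and then is full. So if R = A ∧ B with A, B ≠ R,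
-- the full preorder would lie below both A and B, hence below R.
-- Conversely, let collapse R D be R on a down-closed set D with the rest of the collisions merged into a
-- top class, so that R = collapse R Coll. For y maximal in D, collapse R D is the intersection, hence
-- the meet, of the principal cut at y (the collisions ≤ y below all others) and collapse R (D ∖ ↑y);
-- both are good. By irreducibility R is one of them: the principal cut has two classes (it is not full,
-- as R is not the top), and otherwise D shrinks; for empty D the collapse is full.
-- Finally -1 is the meet of the two singleton cuts at distinct collisions that are comparable in every
-- good preorder: an orthogonal pair, or two adjacent parallel collisions.
module Submission where

open import Defs
open import Data.Nat using (ℕ; _≤_; _+_; _∸_)
open import Data.Maybe using (just; nothing)
open import Data.Product using (_×_)
open import Relation.Nullary using (¬_)
open import Function.Bundles using (_⇔_)

open import Data.Bool using (Bool; true; false; T; not; _∧_; _∨_)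
open import Data.Bool.Properties using (T-≡; T-∧; T-∨)
open import Data.Empty using (⊥-elim)
open import Data.Fin using (Fin; zero; suc; toℕ; _↑ˡ_; _↑ʳ_; splitAt)
open import Data.Fin.Subset using (Subset) renaming (_⊂_ to _⊂ˢ_; _∈_ to _∈ˢ_)
open import Data.Fin.Subset.Induction using (⊂-wellFounded)
import Data.Fin.Properties as Finₚ
open import Data.Nat using (suc; s≤s)
import Data.Nat.Properties as ℕₚ
open import Data.Product using (∃; ∃-syntax; ∃₂; _,_; proj₁; proj₂)
open import Data.Sum using (_⊎_; inj₁; inj₂; [_,_]′; swap) renaming (map to map⊎)
open import Data.Unit using (tt)
open import Data.Vec using (tabulate)
open import Data.Vec.Properties using (lookup∘tabulate; lookup⇒[]=; []=⇒lookup)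
open import Function using (_∘_)
open import Function.Bundles using (mk⇔; module Equivalence)
open import Induction.WellFounded using (WellFounded; Acc; acc; module Subrelation)
import Relation.Binary.Construct.On as On
open import Relation.Binary.Definitions using (DecidableEquality)
open import Relation.Binary.PropositionalEquality using (_≡_; _≢_; refl; sym; trans; cong; subst)
open import Relation.Nullary using (Dec; yes; no)
open import Relation.Nullary.Decidable using (T?; map′; decidable-stable; _×-dec_; ¬?; ⌊_⌋; toWitness; fromWitness)
open import Relation.Unary using (Decidable)

open Equivalence using (to; from)

T-not : ∀ {b} → T (not b) ⇔ (¬ T b)
T-not {false} = mk⇔ (λ _ ()) (λ _ → tt)
T-not {true}  = mk⇔ (λ ()) (λ ¬t → ¬t tt)

T-injective : ∀ {a b} → T a ⇔ T b → a ≡ b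
T-injective {false} {false} _ = refl
T-injective {false} {true}  e = ⊥-elim (from e tt)
T-injective {true}  {false} e = ⊥-elim (to e tt)
T-injective {true}  {true}  _ = refl

InBetween : ∀ {K} → Fin K → Fin K → Fin K → Set
InBetween i s j = (toℕ i ≤ toℕ s × toℕ s ≤ toℕ j) ⊎ (toℕ j ≤ toℕ s × toℕ s ≤ toℕ i)

module _ {K : ℕ} {i s j : Fin K} where

  inBetween-sym : InBetween i s j → InBetween j s i
  inBetween-sym = [ inj₂ , inj₁ ]′

  inBetween-split : ∀ k → InBetween i s j → InBetween i s k ⊎ InBetween k s j
  inBetween-split k (inj₁ (i≤s , s≤j)) with ℕₚ.≤-total (toℕ s) (toℕ k)
  ... | inj₁ s≤k = inj₁ (inj₁ (i≤s , s≤k))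
  ... | inj₂ k≤s = inj₂ (inj₁ (k≤s , s≤j))
  inBetween-split k (inj₂ (j≤s , s≤i)) with ℕₚ.≤-total (toℕ s) (toℕ k)
  ... | inj₁ s≤k = inj₂ (inj₂ (j≤s , s≤k))
  ... | inj₂ k≤s = inj₁ (inj₂ (k≤s , s≤i))

  inBetween-trans : ∀ {s′} → InBetween i s j → InBetween s s′ j → InBetween i s′ j
  inBetween-trans (inj₁ (i≤s , _))   (inj₁ (s≤s′ , s′≤j)) = inj₁ (ℕₚ.≤-trans i≤s s≤s′ , s′≤j)
  inBetween-trans (inj₁ (i≤s , s≤j)) (inj₂ (j≤s′ , s′≤s)) = inj₁ (ℕₚ.≤-trans i≤s (ℕₚ.≤-trans s≤j j≤s′) , ℕₚ.≤-trans s′≤s s≤j)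
  inBetween-trans (inj₂ (j≤s , s≤i)) (inj₁ (s≤s′ , s′≤j)) = inj₂ (ℕₚ.≤-trans j≤s s≤s′ , ℕₚ.≤-trans s′≤j (ℕₚ.≤-trans j≤s s≤i))
  inBetween-trans (inj₂ (_ , s≤i))   (inj₂ (j≤s′ , s′≤s)) = inj₂ (j≤s′ , ℕₚ.≤-trans s′≤s s≤i)

  inBetween-adjacent : toℕ j ≡ 1 + toℕ i → InBetween i s j → s ≡ i ⊎ s ≡ j
  inBetween-adjacent adj (inj₂ (j≤s , s≤i)) = ⊥-elim (ℕₚ.1+n≰n (subst (_≤ toℕ i) adj (ℕₚ.≤-trans j≤s s≤i)))
  inBetween-adjacent adj (inj₁ (i≤s , s≤j)) with s Finₚ.≟ i
  ... | yes s≡i = inj₁ s≡i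
  ... | no s≢i = inj₂ (Finₚ.≤-antisym s≤j (subst (_≤ toℕ s) (sym adj) (Finₚ.≤∧≢⇒< i≤s (s≢i ∘ sym))))

adjacent-distinct : ∀ {K} {i j : Fin K} → toℕ j ≡ 1 + toℕ i → i ≢ j
adjacent-distinct adj refl = ℕₚ.1+n≢n (sym adj)

inBetween-self : ∀ {K} {i s : Fin K} → InBetween i s i → s ≡ i
inBetween-self (inj₁ (i≤s , s≤i)) = Finₚ.≤-antisym s≤i i≤s
inBetween-self (inj₂ (i≤s , s≤i)) = Finₚ.≤-antisym s≤i i≤s

Adjacent : ℕ → Set
Adjacent K = ∃₂ λ (i j : Fin K) → toℕ j ≡ 1 + toℕ i

twoIndices : ∀ K K′ → 2 ≤ K + K′ → (Fin K × Fin K′) ⊎ Adjacent K ⊎ Adjacent K′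
twoIndices (suc K)       (suc K′)       _ = inj₁ (zero , zero)
twoIndices (suc (suc K)) 0              _ = inj₂ (inj₁ (zero , suc zero , refl))
twoIndices 0             (suc (suc K′)) _ = inj₂ (inj₂ (zero , suc zero , refl))
twoIndices 0             0              ()
twoIndices 0             1              (s≤s ())
twoIndices 1             0              (s≤s ())

BoolRel : Set → Set
BoolRel A = A → A → Bool

module _ {A : Set} where

  infix 4 _≤[_]_ _<[_]_ _≈[_]_ _⊆ᵇ_

  _≤[_]_ : A → BoolRel A → A → Set
  x ≤[ R ] y = T (R x y)

  _<[_]_ : A → BoolRel A → A → Set
  x <[ R ] y = x ≤[ R ] y × ¬ (y ≤[ R ] x)

  _≈[_]_ : A → BoolRel A → A → Set
  x ≈[ R ] y = x ≤[ R ] y × y ≤[ R ] x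

  Comparableᵇ : BoolRel A → A → A → Set
  Comparableᵇ R x y = x ≤[ R ] y ⊎ y ≤[ R ] x

  IsPreorderᵇ : BoolRel A → Set
  IsPreorderᵇ R = (∀ x → x ≤[ R ] x) × (∀ x y z → x ≤[ R ] y → y ≤[ R ] z → x ≤[ R ] z)

  _⊆ᵇ_ : BoolRel A → BoolRel A → Set
  R ⊆ᵇ S = ∀ x y → x ≤[ R ] y → x ≤[ S ] y

  DownClosed : BoolRel A → (A → Bool) → Set
  DownClosed R D = ∀ u v → u ≤[ R ] v → T (D v) → T (D u)

  _∖_ : (A → Bool) → (A → Bool) → A → Bool
  (D ∖ E) x = D x ∧ not (E x)

  ∖-⊆ : ∀ {D E} x → T ((D ∖ E) x) → T (D x)
  ∖-⊆ _ = proj₁ ∘ to T-∧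

  ≤-<-trans : ∀ {R x y z} → IsPreorderᵇ R → x ≤[ R ] y → y <[ R ] z → x <[ R ] z
  ≤-<-trans (_ , tr) x≤y (y≤z , z≰y) = tr _ _ _ x≤y y≤z , λ z≤x → z≰y (tr _ _ _ z≤x x≤y)

  below : BoolRel A → A → A → Bool
  below R y u = R u y

  full : BoolRel A
  full _ _ = true

  -- The preorder with the two classes p (below) and its complement (above).
  cut : (A → Bool) → BoolRel A
  cut p u v = p u ∨ not (p v)

  -- R restricted to D, with the complement of D collapsed into one class on top.
  collapse : BoolRel A → (A → Bool) → BoolRel A
  collapse R D u v = not (D v) ∨ (D u ∧ R u v)

  module _ (p : A → Bool) where

    cut-isPreorder : IsPreorderᵇ (cut p)
    cut-isPreorder = refl′ , trans′
      where
      refl′ : ∀ x → x ≤[ cut p ] x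
      refl′ x with p x
      ... | true  = tt
      ... | false = tt
      trans′ : ∀ x y z → x ≤[ cut p ] y → y ≤[ cut p ] z → x ≤[ cut p ] z
      trans′ x y z with p x | p y
      ... | true  | _     = λ _ _ → tt
      ... | false | true  = λ ()
      ... | false | false = λ _ y≤z → y≤z

    cut-total : ∀ x y → Comparableᵇ (cut p) x y
    cut-total x y with p x | p y
    ... | true  | _     = inj₁ tt
    ... | false | true  = inj₂ tt
    ... | false | false = inj₂ tt

    cut-below : ∀ {u v} → T (p u) → u ≤[ cut p ] v
    cut-below pu = from T-∨ (inj₁ pu)

    cut-above : ∀ {u v} → ¬ T (p v) → u ≤[ cut p ] v
    cut-above ¬pv = from T-∨ (inj₂ (from T-not ¬pv))

    cut-≤⁻ : ∀ {u v} → u ≤[ cut p ] v → T (p u) ⊎ ¬ T (p v)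
    cut-≤⁻ = map⊎ (λ pu → pu) (to T-not) ∘ to T-∨

    cut-<⁻ : ∀ {u v} → u <[ cut p ] v → T (p u) × ¬ T (p v)
    cut-<⁻ {u} (_ , v≰u) = decidable-stable (T? (p u)) (v≰u ∘ cut-above) , v≰u ∘ cut-below

  module _ (R : BoolRel A) (D : A → Bool) where

    collapse-outside : ∀ {u v} → ¬ T (D v) → u ≤[ collapse R D ] v
    collapse-outside ¬Dv = from T-∨ (inj₁ (from T-not ¬Dv))

    collapse-inside : ∀ {u v} → T (D u) → u ≤[ R ] v → u ≤[ collapse R D ] v
    collapse-inside Du u≤v = from T-∨ (inj₂ (from T-∧ (Du , u≤v)))

    collapse-inside⁻ : ∀ {u v} → T (D v) → u ≤[ collapse R D ] v → T (D u) × u ≤[ R ] v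
    collapse-inside⁻ Dv u≤v with to T-∨ u≤v
    ... | inj₁ ¬Dv = ⊥-elim (to T-not ¬Dv Dv)
    ... | inj₂ h   = to T-∧ h

    ⊆-collapse : DownClosed R D → R ⊆ᵇ collapse R D
    ⊆-collapse dc u v u≤v with T? (D v)
    ... | yes Dv = collapse-inside (dc u v u≤v Dv) u≤v
    ... | no ¬Dv = collapse-outside ¬Dv

    collapse-isPreorder : IsPreorderᵇ R → DownClosed R D → IsPreorderᵇ (collapse R D)
    collapse-isPreorder (rf , tr) dc = (λ x → ⊆-collapse dc x x (rf x)) , trans′
      where
      trans′ : ∀ x y z → x ≤[ collapse R D ] y → y ≤[ collapse R D ] z → x ≤[ collapse R D ] z
      trans′ x y z x≤y y≤z with T? (D z)
      ... | no ¬Dz = collapse-outside ¬Dz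
      ... | yes Dz =
        let (Dy , y≤ᴿz) = collapse-inside⁻ Dz y≤z
            (Dx , x≤ᴿy) = collapse-inside⁻ Dy x≤y
        in collapse-inside Dx (tr x y z x≤ᴿy y≤ᴿz)

  module _ {R : BoolRel A} (isPre : IsPreorderᵇ R) {D : A → Bool} (dc : DownClosed R D) where

    private
      tr = proj₂ isPre

    ∖-upset-downClosed : ∀ y → DownClosed R (D ∖ R y)
    ∖-upset-downClosed y u v u≤v D∖v =
      let (Dv , y≰v) = to T-∧ D∖v
      in from T-∧ (dc u v u≤v Dv , from T-not (λ y≤u → to T-not y≰v (tr y u v y≤u u≤v)))

    collapse-antitone : ∀ {D′} → DownClosed R D′ → (∀ u → T (D′ u) → T (D u)) →
                        collapse R D ⊆ᵇ collapse R D′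
    collapse-antitone {D′} dc′ D′⊆D u v u≤v with T? (D′ v)
    ... | no ¬D′v = collapse-outside R D′ ¬D′v
    ... | yes D′v = let (_ , u≤ᴿv) = collapse-inside⁻ R D (D′⊆D v D′v) u≤v
                    in collapse-inside R D′ (dc′ u v u≤ᴿv D′v) u≤ᴿv

    collapse⊆principalCut : ∀ {y} → T (D y) → collapse R D ⊆ᵇ cut (below R y)
    collapse⊆principalCut {y} Dy u v u≤v with T? (R v y)
    ... | no v≰y  = cut-above (below R y) v≰y
    ... | yes v≤y = cut-below (below R y) (tr u v y (proj₂ (collapse-inside⁻ R D (dc v y v≤y Dy) u≤v)) v≤y)

    principalCut∩collapse⊆collapse :
      ∀ {y} → T (D y) → (∀ v → T (D v) → y ≤[ R ] v → v ≤[ R ] y) →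
      ∀ u v → u ≤[ cut (below R y) ] v → u ≤[ collapse R (D ∖ R y) ] v → u ≤[ collapse R D ] v
    principalCut∩collapse⊆collapse {y} Dy maximal u v u≤v u≤′v with T? (D v) | T? (R y v)
    ... | no ¬Dv | _        = collapse-outside R D ¬Dv
    ... | yes Dv | no y≰v   =
      let (D∖u , u≤ᴿv) = collapse-inside⁻ R (D ∖ R y) (from T-∧ (Dv , from T-not y≰v)) u≤′v
      in collapse-inside R D (proj₁ (to T-∧ D∖u)) u≤ᴿv
    ... | yes Dv | yes y≤v with cut-≤⁻ (below R y) u≤v
    ...   | inj₁ u≤y = collapse-inside R D (dc u y u≤y Dy) (tr u y v u≤y y≤v)
    ...   | inj₂ v≰y = ⊥-elim (v≰y (maximal v Dv y≤v))

-- With (par, orth) = (mc, lc) and (lc, mc) these are LinkM, GapM and LinkL, GapL, and IsGood R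
-- unfolds to IsPreorderᵇ R, orthogonal comparability and the two ParallelConditions.
module Parallel {A : Set} {K K′ : ℕ} (par : Fin K → A) (orth : Fin K′ → A) where

  Link : BoolRel A → Fin K → Fin K → Set
  Link R i j = ∃[ s ] ((par i ≤[ R ] orth s × orth s ≤[ R ] par j) ⊎ (par j ≤[ R ] orth s × orth s ≤[ R ] par i))

  Gap : BoolRel A → Fin K → Fin K → Set
  Gap R i j = ∃[ s ] (InBetween i s j × par i <[ R ] par s × par j <[ R ] par s)

  ParallelCondition : BoolRel A → Set
  ParallelCondition R = ∀ i j → Comparableᵇ R (par i) (par j) ⇔ (Link R i j ⊎ ¬ Gap R i j)

  gap-sym : ∀ {R i j} → Gap R i j → Gap R j i
  gap-sym (s , b , i<s , j<s) = s , inBetween-sym b , j<s , i<s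

  noGap-of-covered : ∀ {R i j} → (∀ s → par s ≤[ R ] par i ⊎ par s ≤[ R ] par j) → ¬ Gap R i j
  noGap-of-covered covered (s , _ , (_ , s≰i) , (_ , s≰j)) = [ s≰i , s≰j ]′ (covered s)

  module _ {R : BoolRel A} (isPre : IsPreorderᵇ R) (cond : ParallelCondition R) where

    private
      tr = proj₂ isPre

    noGap-shrink : ∀ {i j s} → par i ≤[ R ] par j → ¬ Gap R i j → InBetween i s j → ¬ Gap R s j
    noGap-shrink i≤j noGap b (s′ , b′ , _ , j<s′) =
      noGap (s′ , inBetween-trans b b′ , ≤-<-trans isPre i≤j j<s′ , j<s′)

    ≤-of-noGap : ∀ {i j s} → par i ≤[ R ] par j → ¬ Gap R i j → InBetween i s j → par s ≤[ R ] par j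
    ≤-of-noGap {i} {j} {s} i≤j noGap b with from (cond s j) (inj₂ (noGap-shrink i≤j noGap b))
    ... | inj₁ s≤j = s≤j
    ... | inj₂ j≤s = decidable-stable (T? _) λ s≰j →
                       noGap (s , b , ≤-<-trans isPre i≤j (j≤s , s≰j) , (j≤s , s≰j))

    noGap-of-noOrthBelow : ∀ {i k} → par i ≤[ R ] par k → (∀ l → ¬ orth l ≤[ R ] par k) → ¬ Gap R i k
    noGap-of-noOrthBelow {i} {k} i≤k noOrth gap with to (cond i k) (inj₁ i≤k)
    ... | inj₂ noGap                  = noGap gap
    ... | inj₁ (l , inj₁ (_ , l≤k))   = noOrth l l≤k
    ... | inj₁ (l , inj₂ (_ , l≤i))   = noOrth l (tr _ _ _ l≤i i≤k)

    ≤-of-noOrthBelow : ∀ {i j k s} → par i ≤[ R ] par k → par j ≤[ R ] par k →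
                       (∀ l → ¬ orth l ≤[ R ] par k) → InBetween i s j → par s ≤[ R ] par k
    ≤-of-noOrthBelow {k = k} i≤k j≤k noOrth b with inBetween-split k b
    ... | inj₁ b₁ = ≤-of-noGap i≤k (noGap-of-noOrthBelow i≤k noOrth) b₁
    ... | inj₂ b₂ = ≤-of-noGap j≤k (noGap-of-noOrthBelow j≤k noOrth) (inBetween-sym b₂)

    adjacent-comparable : ∀ {i j} → toℕ j ≡ 1 + toℕ i → Comparableᵇ R (par i) (par j)
    adjacent-comparable {i} {j} adj = from (cond i j) (inj₂ noGap)
      where
      noGap : ¬ Gap R i j
      noGap (s , b , (_ , s≰i) , (_ , s≰j)) with inBetween-adjacent adj b
      ... | inj₁ refl = s≰i (proj₁ isPre _)
      ... | inj₂ refl = s≰j (proj₁ isPre _)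

  ConvexOrMeetsOrth : (A → Bool) → Set
  ConvexOrMeetsOrth p = ∀ {i j s} → T (p (par i)) → T (p (par j)) → InBetween i s j → ¬ T (p (par s)) →
                        ∃[ l ] T (p (orth l))

  cut-parallelCondition : ∀ p → ConvexOrMeetsOrth p → ParallelCondition (cut p)
  cut-parallelCondition p convex i j = mk⇔ linkOrNoGap (λ _ → cut-total p (par i) (par j))
    where
    linkOrNoGap : Comparableᵇ (cut p) (par i) (par j) → Link (cut p) i j ⊎ ¬ Gap (cut p) i j
    linkOrNoGap _ with T? (p (par i)) ×-dec Finₚ.any? (λ l → T? (p (orth l)))
    ... | yes (pi , l , pl) = inj₁ (l , inj₁ (cut-below p pi , cut-below p pl))
    ... | no ¬both          = inj₂ λ (s , b , i<s , j<s) →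
      let (pi , ¬ps) = cut-<⁻ p i<s
          (pj , _)   = cut-<⁻ p j<s
      in ¬both (pi , convex pi pj b ¬ps)

  orthPrincipal-convex : ∀ {R} → (∀ x → x ≤[ R ] x) → ∀ k → ConvexOrMeetsOrth (below R (orth k))
  orthPrincipal-convex rf k _ _ _ _ = k , rf (orth k)

  parPrincipal-convex : ∀ {R} → IsPreorderᵇ R → ParallelCondition R → ∀ k → ConvexOrMeetsOrth (below R (par k))
  parPrincipal-convex {R} isPre cond k pi pj b ¬ps =
    decidable-stable (Finₚ.any? (λ l → T? (R (orth l) (par k)))) λ noOrth →
      ¬ps (≤-of-noOrthBelow isPre cond pi pj (λ l l≤k → noOrth (l , l≤k)) b)

  singleton-convex : ∀ p → (∀ {i j} → T (p (par i)) → T (p (par j)) → i ≡ j) → ConvexOrMeetsOrth p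
  singleton-convex p unique pi pj b ¬ps with unique pi pj
  ... | refl = ⊥-elim (¬ps (subst (T ∘ p ∘ par) (sym (inBetween-self b)) pi))

  module _ {R : BoolRel A} (isPre : IsPreorderᵇ R) (cond : ParallelCondition R)
           {D : A → Bool} (dc : DownClosed R D) where

    private
      Q = collapse R D

    noGap-collapse-outside : ∀ {i j} → ¬ T (D (par j)) → ¬ Gap Q i j
    noGap-collapse-outside ¬Dj (_ , _ , _ , (_ , s≰j)) = s≰j (collapse-outside R D ¬Dj)

    module _ {i j} (Di : T (D (par i))) (Dj : T (D (par j))) where

      comparable-of-collapse : Comparableᵇ Q (par i) (par j) → Comparableᵇ R (par i) (par j)
      comparable-of-collapse = map⊎ (proj₂ ∘ collapse-inside⁻ R D Dj) (proj₂ ∘ collapse-inside⁻ R D Di)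

      link-collapse : Link R i j → Link Q i j
      link-collapse (l , inj₁ (i≤l , l≤j)) =
        l , inj₁ (collapse-inside R D Di i≤l , collapse-inside R D (dc _ _ l≤j Dj) l≤j)
      link-collapse (l , inj₂ (j≤l , l≤i)) =
        l , inj₂ (collapse-inside R D Dj j≤l , collapse-inside R D (dc _ _ l≤i Di) l≤i)

      gap-collapse : Gap R i j → Gap Q i j
      gap-collapse (s , b , (i≤s , s≰i) , (j≤s , s≰j)) =
        s , b , (⊆-collapse R D dc _ _ i≤s , s≰i ∘ proj₂ ∘ collapse-inside⁻ R D Di)
              , (⊆-collapse R D dc _ _ j≤s , s≰j ∘ proj₂ ∘ collapse-inside⁻ R D Dj)

      -- A gap s outside D is impossible: in R, s lies below i or j, which are in D.
      noGap-collapse : ¬ Gap R i j → ¬ Gap Q i j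
      noGap-collapse noGap (s , b , (i≤s , s≰i) , (j≤s , s≰j)) with T? (D (par s))
      ... | yes Ds =
        noGap (s , b , (proj₂ (collapse-inside⁻ R D Ds i≤s) , s≰i ∘ collapse-inside R D Ds)
                     , (proj₂ (collapse-inside⁻ R D Ds j≤s) , s≰j ∘ collapse-inside R D Ds))
      ... | no ¬Ds with from (cond i j) (inj₂ noGap)
      ...   | inj₁ i≤j = ¬Ds (dc _ _ (≤-of-noGap isPre cond i≤j noGap b) Dj)
      ...   | inj₂ j≤i = ¬Ds (dc _ _ (≤-of-noGap isPre cond j≤i (noGap ∘ gap-sym {R}) (inBetween-sym b)) Di)

    collapse-parallelCondition : ParallelCondition Q
    collapse-parallelCondition i j with T? (D (par i)) | T? (D (par j))
    ... | _       | no ¬Dj = mk⇔ (λ _ → inj₂ (noGap-collapse-outside ¬Dj))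
                                 (λ _ → inj₁ (collapse-outside R D ¬Dj))
    ... | no ¬Di  | yes _  = mk⇔ (λ _ → inj₂ (noGap-collapse-outside ¬Di ∘ gap-sym {Q}))
                                 (λ _ → inj₂ (collapse-outside R D ¬Di))
    ... | yes Di  | yes Dj = mk⇔ linkOrNoGap comparable
      where
      linkOrNoGap : Comparableᵇ Q (par i) (par j) → Link Q i j ⊎ ¬ Gap Q i j
      linkOrNoGap = map⊎ (link-collapse Di Dj) (noGap-collapse Di Dj) ∘ to (cond i j) ∘ comparable-of-collapse Di Dj
      comparable : Link Q i j ⊎ ¬ Gap Q i j → Comparableᵇ Q (par i) (par j)
      comparable (inj₁ (l , inj₁ (i≤l , l≤j))) = inj₁ (proj₂ (collapse-isPreorder R D isPre dc) _ _ _ i≤l l≤j)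
      comparable (inj₁ (l , inj₂ (j≤l , l≤i))) = inj₂ (proj₂ (collapse-isPreorder R D isPre dc) _ _ _ j≤l l≤i)
      comparable (inj₂ noGap) =
        map⊎ (⊆-collapse R D dc _ _) (⊆-collapse R D dc _ _) (from (cond i j) (inj₂ (noGap ∘ gap-collapse Di Dj)))

module _ {m n : ℕ} where

  private
    module PM = Parallel {Coll m n} mc lc
    module PL = Parallel {Coll m n} lc mc

  cut-good : ∀ p → PM.ConvexOrMeetsOrth p → PL.ConvexOrMeetsOrth p → IsGood (cut p)
  cut-good p convexM convexL =
    cut-isPreorder p , (λ j i → cut-total p (mc j) (lc i)) ,
    PM.cut-parallelCondition p convexM , PL.cut-parallelCondition p convexL

  full-good : IsGood {m} {n} full
  full-good = cut-good (λ _ → false) (λ ()) (λ ())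

  principalCut-good : ∀ {R : Rel m n} → IsGood R → ∀ y → IsGood (cut (below R y))
  principalCut-good {R} (isPre , _ , condM , condL) (mc k) =
    cut-good (below R (mc k)) (PM.parPrincipal-convex isPre condM k) (PL.orthPrincipal-convex {R} (proj₁ isPre) k)
  principalCut-good {R} (isPre , _ , condM , condL) (lc k) =
    cut-good (below R (lc k)) (PM.orthPrincipal-convex {R} (proj₁ isPre) k) (PL.parPrincipal-convex isPre condL k)

  collapse-good : ∀ {R : Rel m n} {D} → IsGood R → DownClosed R D → IsGood (collapse R D)
  collapse-good {R} {D} (isPre , orthC , condM , condL) dc =
    collapse-isPreorder R D isPre dc ,
    (λ j i → map⊎ (⊆-collapse R D dc _ _) (⊆-collapse R D dc _ _) (orthC j i)) ,
    PM.collapse-parallelCondition isPre condM dc , PL.collapse-parallelCondition isPre condL dc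

  mc-injective : ∀ {i j} → mc {m} {n} i ≡ mc j → i ≡ j
  mc-injective refl = refl

  lc-injective : ∀ {i j} → lc {m} {n} i ≡ lc j → i ≡ j
  lc-injective refl = refl

  _≟_ : DecidableEquality (Coll m n)
  mc i ≟ mc j = map′ (cong mc) mc-injective (i Finₚ.≟ j)
  lc i ≟ lc j = map′ (cong lc) lc-injective (i Finₚ.≟ j)
  mc _ ≟ lc _ = no λ ()
  lc _ ≟ mc _ = no λ ()

  singleton : Coll m n → Coll m n → Bool
  singleton x u = ⌊ u ≟ x ⌋

  singletonCut-good : ∀ x → IsGood (cut (singleton x))
  singletonCut-good x =
    cut-good (singleton x) (PM.singleton-convex (singleton x) (λ pu pv → mc-injective (sameAs pu pv)))
                           (PL.singleton-convex (singleton x) (λ pu pv → lc-injective (sameAs pu pv)))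
    where
    sameAs : ∀ {u v} → T (singleton x u) → T (singleton x v) → u ≡ v
    sameAs u≡x v≡x = trans (toWitness u≡x) (sym (toWitness v≡x))

  singletonCut-≤⁻ : ∀ {x y} → x ≤[ cut (singleton y) ] y → x ≡ y
  singletonCut-≤⁻ {x} {y} x≤y with cut-≤⁻ (singleton y) x≤y
  ... | inj₁ x≡y = toWitness {a? = x ≟ y} x≡y
  ... | inj₂ y≢y = ⊥-elim (y≢y (fromWitness {a? = y ≟ y} refl))

  toFin : Coll m n → Fin ((m ∸ 1) + (n ∸ 1))
  toFin (mc i) = i ↑ˡ (n ∸ 1)
  toFin (lc j) = (m ∸ 1) ↑ʳ j

  fromFin : Fin ((m ∸ 1) + (n ∸ 1)) → Coll m n
  fromFin k = [ mc , lc ]′ (splitAt (m ∸ 1) k)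

  fromFin-toFin : ∀ x → fromFin (toFin x) ≡ x
  fromFin-toFin (mc i) = cong [ mc , lc ]′ (Finₚ.splitAt-↑ˡ (m ∸ 1) i (n ∸ 1))
  fromFin-toFin (lc j) = cong [ mc , lc ]′ (Finₚ.splitAt-↑ʳ (m ∸ 1) (n ∸ 1) j)

  any? : ∀ {P : Coll m n → Set} → Decidable P → Dec (∃ P)
  any? {P} P? = map′ (λ (k , Pk) → fromFin k , Pk)
                     (λ (x , Px) → toFin x , subst P (sym (fromFin-toFin x)) Px)
                     (Finₚ.any? (P? ∘ fromFin))

  infix 4 _⊊_

  _⊊_ : (Coll m n → Bool) → (Coll m n → Bool) → Set
  p ⊊ q = (∀ x → T (p x) → T (q x)) × ∃[ x ] (T (q x) × ¬ T (p x))

  ⊊-wellFounded : WellFounded _⊊_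
  ⊊-wellFounded = Subrelation.wellFounded ⊊⇒⊂ˢ (On.wellFounded toSubset ⊂-wellFounded)
    where
    toSubset : (Coll m n → Bool) → Subset ((m ∸ 1) + (n ∸ 1))
    toSubset p = tabulate (p ∘ fromFin)
    ∈-toSubset : ∀ {p k} → T (p (fromFin k)) → k ∈ˢ toSubset p
    ∈-toSubset {p} {k} pk = lookup⇒[]= k (toSubset p) (trans (lookup∘tabulate (p ∘ fromFin) k) (to T-≡ pk))
    ∈-toSubset⁻ : ∀ {p k} → k ∈ˢ toSubset p → T (p (fromFin k))
    ∈-toSubset⁻ {p} {k} k∈p = from T-≡ (trans (sym (lookup∘tabulate (p ∘ fromFin) k)) ([]=⇒lookup k∈p))
    ⊊⇒⊂ˢ : ∀ {p q} → p ⊊ q → toSubset p ⊂ˢ toSubset q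
    ⊊⇒⊂ˢ {p} {q} (p⊆q , x , qx , ¬px) =
      (λ k∈p → ∈-toSubset {q} (p⊆q _ (∈-toSubset⁻ {p} k∈p))) ,
      toFin x , ∈-toSubset {q} (subst (T ∘ q) (sym (fromFin-toFin x)) qx) ,
      λ x∈p → ¬px (subst (T ∘ p) (fromFin-toFin x) (∈-toSubset⁻ {p} x∈p))

  ∖-⊊ : ∀ {D E : Coll m n → Bool} {y} → T (D y) → T (E y) → D ∖ E ⊊ D
  ∖-⊊ {y = y} Dy Ey = ∖-⊆ , y , Dy , λ D∖y → to T-not (proj₂ (to T-∧ D∖y)) Ey

  Maximal : Rel m n → (Coll m n → Bool) → Coll m n → Set
  Maximal R D y = T (D y) × (∀ v → T (D v) → y ≤[ R ] v → v ≤[ R ] y)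

  maximal-exists : ∀ {R : Rel m n} → IsPreorderᵇ R → ∀ D {y} → T (D y) → ∃ (Maximal R D)
  maximal-exists {R} (rf , tr) D {y} Dy = go y (⊊-wellFounded (R y)) Dy
    where
    go : ∀ y → Acc _⊊_ (R y) → T (D y) → ∃ (Maximal R D)
    go y (acc smaller) Dy with any? (λ v → T? (D v) ×-dec T? (R y v) ×-dec ¬? (T? (R v y)))
    ... | yes (v , Dv , y≤v , v≰y) = go v (smaller ((λ x v≤x → tr y v x y≤v v≤x) , y , rf y , v≰y)) Dv
    ... | no noneAbove             = y , Dy , λ v Dv y≤v →
                                       decidable-stable (T? (R v y)) (λ v≰y → noneAbove (v , Dv , y≤v , v≰y))

  ≈⇒⊆ : ∀ {R S : Rel m n} → just R ≈L just S → R ⊆ᵇ S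
  ≈⇒⊆ R≈S u v = subst T (R≈S u v)

  ≈⇒⊇ : ∀ {R S : Rel m n} → just R ≈L just S → S ⊆ᵇ R
  ≈⇒⊇ R≈S u v = subst T (sym (R≈S u v))

  full⇒isTop : ∀ {R : Rel m n} → (∀ u v → u ≤[ R ] v) → IsTop (just R)
  full⇒isTop R-full nothing  _ = tt
  full⇒isTop R-full (just Z) _ u v _ = R-full u v

  isMeet-of-intersection : ∀ {R A B : Rel m n} → R ⊆ᵇ A → R ⊆ᵇ B →
                           (∀ u v → u ≤[ A ] v → u ≤[ B ] v → u ≤[ R ] v) → IsMeet (just R) (just A) (just B)
  isMeet-of-intersection R⊆A R⊆B A∩B⊆R = R⊆A , R⊆B , greatest
    where
    greatest : ∀ z → InL z → z ≤L _ → z ≤L _ → z ≤L _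
    greatest nothing  _ _ _ = tt
    greatest (just Z) _ Z⊆A Z⊆B u v u≤v = A∩B⊆R u v (Z⊆A u v u≤v) (Z⊆B u v u≤v)

  collapse-peel-isMeet : ∀ {R : Rel m n} {D y} → IsPreorderᵇ R → DownClosed R D →
                         just R ≈L just (collapse R D) → Maximal R D y →
                         IsMeet (just R) (just (cut (below R y))) (just (collapse R (D ∖ R y)))
  collapse-peel-isMeet {R} {D} {y} isPre dc R≈ (Dy , maximal) =
    isMeet-of-intersection
      (λ u v → collapse⊆principalCut isPre dc Dy u v ∘ ≈⇒⊆ R≈ u v)
      (λ u v → collapse-antitone isPre dc (∖-upset-downClosed isPre dc y) ∖-⊆ u v ∘ ≈⇒⊆ R≈ u v)
      (λ u v u≤v u≤′v → ≈⇒⊇ R≈ u v (principalCut∩collapse⊆collapse isPre dc Dy maximal u v u≤v u≤′v))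

  twoClasses-resp-≈ : ∀ {R S : Rel m n} → just R ≈L just S → TwoClasses S → TwoClasses R
  twoClasses-resp-≈ R≈S (x , y , x≉y , cover) =
    x , y , (λ (x≤y , y≤x) → x≉y (≈⇒⊆ R≈S _ _ x≤y , ≈⇒⊆ R≈S _ _ y≤x)) ,
    λ z → map⊎ (λ (z≤x , x≤z) → ≈⇒⊇ R≈S _ _ z≤x , ≈⇒⊇ R≈S _ _ x≤z)
               (λ (z≤y , y≤z) → ≈⇒⊇ R≈S _ _ z≤y , ≈⇒⊇ R≈S _ _ y≤z) (cover z)

  cut-twoClasses : ∀ (p : Coll m n → Bool) {x y} → ¬ T (p x) → T (p y) → TwoClasses (cut p)
  cut-twoClasses p {x} {y} ¬px py = x , y , x≉y , cover
    where
    x≉y : ¬ (x ≈[ cut p ] y)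
    x≉y (x≤y , _) = [ ¬px , (λ ¬py → ¬py py) ]′ (cut-≤⁻ p x≤y)
    cover : ∀ z → z ≈[ cut p ] x ⊎ z ≈[ cut p ] y
    cover z with T? (p z)
    ... | yes pz = inj₂ (cut-below p pz , cut-below p py)
    ... | no ¬pz = inj₁ (cut-above p ¬px , cut-above p ¬pz)

  meetIrreducible⇒twoClasses : ∀ {R : Rel m n} → IsGood R → MeetIrreducible (just R) → TwoClasses R
  meetIrreducible⇒twoClasses {R} good (_ , notTop , irreducible) =
    descend (λ _ → true) (⊊-wellFounded _) (λ _ _ _ _ → tt) (λ _ _ → refl)
    where
    isPre = proj₁ good
    notFull : ∀ {S} → just R ≈L just S → ¬ (∀ u v → u ≤[ S ] v)
    notFull R≈S S-full = notTop (full⇒isTop λ u v → ≈⇒⊇ R≈S u v (S-full u v))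
    descend : ∀ D → Acc _⊊_ D → DownClosed R D → just R ≈L just (collapse R D) → TwoClasses R
    descend D (acc smaller) dc R≈ with any? (T? ∘ D)
    ... | no empty = ⊥-elim (notFull R≈ λ u v → collapse-outside R D (λ Dv → empty (v , Dv)))
    ... | yes (_ , Dy₀) with maximal-exists isPre D Dy₀
    ...   | y , ymax@(Dy , _)
          with irreducible (just (cut (below R y))) (just (collapse R (D ∖ R y)))
                 (principalCut-good good y) (collapse-good good (∖-upset-downClosed isPre dc y))
                 (collapse-peel-isMeet isPre dc R≈ ymax)
    ...     | inj₂ R≈collapse =
              descend (D ∖ R y) (smaller (∖-⊊ Dy (proj₁ isPre y))) (∖-upset-downClosed isPre dc y) R≈collapse
    ...     | inj₁ R≈cut with any? (λ x → ¬? (T? (R x y)))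
    ...       | yes (x , x≰y) = twoClasses-resp-≈ R≈cut (cut-twoClasses (below R y) {x} {y} x≰y (proj₁ isPre y))
    ...       | no allBelow   = ⊥-elim (notFull R≈cut λ u v →
                                  cut-below (below R y) (decidable-stable (T? (R u y)) (λ u≰y → allBelow (u , u≰y))))

  representatives-comparable : ∀ {R : Rel m n} {x y} → IsGood R →
                               (∀ z → z ≤[ R ] x ⊎ z ≤[ R ] y) → Comparableᵇ R x y
  representatives-comparable {R} {mc i} {mc j} (_ , _ , condM , _) covered =
    from (condM i j) (inj₂ (PM.noGap-of-covered {R} (covered ∘ mc)))
  representatives-comparable {R} {lc i} {lc j} (_ , _ , _ , condL) covered =
    from (condL i j) (inj₂ (PL.noGap-of-covered {R} (covered ∘ lc)))
  representatives-comparable {x = mc i} {lc j} (_ , orthC , _) _ = orthC i j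
  representatives-comparable {x = lc i} {mc j} (_ , orthC , _) _ = swap (orthC j i)

  module TwoClassPreorder {R : Rel m n} (isPre : IsPreorderᵇ R) {b t} (b<t : b <[ R ] t)
                          (cover : ∀ z → z ≈[ R ] b ⊎ z ≈[ R ] t) where

    private
      tr = proj₂ isPre

    b-least : ∀ z → b ≤[ R ] z
    b-least z = [ proj₂ , tr b t z (proj₁ b<t) ∘ proj₂ ]′ (cover z)

    t-greatest : ∀ z → z ≤[ R ] t
    t-greatest z = [ (λ (z≤b , _) → tr z b t z≤b (proj₁ b<t)) , proj₁ ]′ (cover z)

    ≰⇒top-bottom : ∀ {u v} → ¬ u ≤[ R ] v → t ≤[ R ] u × v ≤[ R ] b
    ≰⇒top-bottom {u} {v} u≰v with cover u | cover v
    ... | inj₁ (u≤b , _) | _              = ⊥-elim (u≰v (tr u b v u≤b (b-least v)))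
    ... | inj₂ _         | inj₂ (_ , t≤v) = ⊥-elim (u≰v (tr u t v (t-greatest u) t≤v))
    ... | inj₂ (_ , t≤u) | inj₁ (v≤b , _) = t≤u , v≤b

    coarsening-full : ∀ {S} → IsPreorderᵇ S → R ⊆ᵇ S → t ≤[ S ] b → ∀ u v → u ≤[ S ] v
    coarsening-full (_ , trS) R⊆S t≤b u v =
      trS u t v (R⊆S u t (t-greatest u)) (trS t b v t≤b (R⊆S b v (b-least v)))

    coarsening-equal : ∀ {S} → IsPreorderᵇ S → R ⊆ᵇ S → ¬ t ≤[ S ] b → just R ≈L just S
    coarsening-equal {S} (_ , trS) R⊆S t≰b u v = T-injective (mk⇔ (R⊆S u v) S⊆R)
      where
      S⊆R : u ≤[ S ] v → u ≤[ R ] v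
      S⊆R u≤v = decidable-stable (T? (R u v)) λ u≰v →
        let (t≤u , v≤b) = ≰⇒top-bottom u≰v
        in t≰b (trS t u b (R⊆S t u t≤u) (trS u v b u≤v (R⊆S v b v≤b)))

    meetIrreducible : IsGood R → MeetIrreducible (just R)
    meetIrreducible good = good , notTop , irreducible
      where
      notTop : ¬ IsTop (just R)
      notTop top = proj₂ b<t (top (just full) full-good t b tt)
      irreducible : ∀ A B → InL A → InL B → IsMeet (just R) A B → just R ≈L A ⊎ just R ≈L B
      irreducible nothing  _        _     _     (() , _)
      irreducible (just _) nothing  _     _     (_ , () , _)
      irreducible (just A) (just B) goodA goodB (R⊆A , R⊆B , greatest)
        with T? (A t b) | T? (B t b)
      ... | no t≰ᴬb  | _        = inj₁ (coarsening-equal (proj₁ goodA) R⊆A t≰ᴬb)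
      ... | yes _    | no t≰ᴮb  = inj₂ (coarsening-equal (proj₁ goodB) R⊆B t≰ᴮb)
      ... | yes t≤ᴬb | yes t≤ᴮb = ⊥-elim (notTop (full⇒isTop λ u v →
            greatest (just full) full-good
              (λ x y _ → coarsening-full (proj₁ goodA) R⊆A t≤ᴬb x y)
              (λ x y _ → coarsening-full (proj₁ goodB) R⊆B t≤ᴮb x y) u v tt))

  twoClasses⇒meetIrreducible : ∀ {R : Rel m n} → IsGood R → TwoClasses R → MeetIrreducible (just R)
  twoClasses⇒meetIrreducible {R} good (x , y , x≉y , cover)
    with representatives-comparable good (λ z → map⊎ proj₁ proj₁ (cover z))
  ... | inj₁ x≤y = TwoClassPreorder.meetIrreducible (proj₁ good) (x≤y , x≉y ∘ (x≤y ,_)) cover good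
  ... | inj₂ y≤x = TwoClassPreorder.meetIrreducible (proj₁ good) (y≤x , x≉y ∘ (_, y≤x)) (swap ∘ cover) good

  singletonCuts-meet-bottom : ∀ {x y : Coll m n} → x ≢ y → (∀ Z → IsGood Z → Comparableᵇ Z x y) →
                              IsMeet nothing (just (cut (singleton x))) (just (cut (singleton y)))
  singletonCuts-meet-bottom {x} {y} x≢y comparable = tt , tt , greatest
    where
    greatest : ∀ z → InL z → z ≤L just (cut (singleton x)) → z ≤L just (cut (singleton y)) → z ≤L nothing
    greatest nothing  _    _   _ = tt
    greatest (just Z) good Z⊆x Z⊆y with comparable Z good
    ... | inj₁ x≤y = x≢y (singletonCut-≤⁻ (Z⊆y x y x≤y))
    ... | inj₂ y≤x = x≢y (sym (singletonCut-≤⁻ (Z⊆x y x y≤x)))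

  bottom-not-meetIrreducible : ∀ {x y : Coll m n} → x ≢ y → (∀ Z → IsGood Z → Comparableᵇ Z x y) →
                               ¬ MeetIrreducible {m} {n} nothing
  bottom-not-meetIrreducible {x} {y} x≢y comparable (_ , _ , irreducible)
    with irreducible _ _ (singletonCut-good x) (singletonCut-good y) (singletonCuts-meet-bottom x≢y comparable)
  ... | inj₁ ()
  ... | inj₂ ()

  alwaysComparable-pair : 2 ≤ (m ∸ 1) + (n ∸ 1) →
                          ∃₂ λ (x y : Coll m n) → x ≢ y × (∀ Z → IsGood Z → Comparableᵇ Z x y)
  alwaysComparable-pair two with twoIndices (m ∸ 1) (n ∸ 1) two
  ... | inj₁ (i , j)              = mc i , lc j , (λ ()) , λ _ (_ , orthC , _) → orthC i j
  ... | inj₂ (inj₁ (i , j , adj)) = mc i , mc j , adjacent-distinct adj ∘ mc-injective ,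
                                    λ Z (isPre , _ , condM , _) → PM.adjacent-comparable {Z} isPre condM adj
  ... | inj₂ (inj₂ (i , j , adj)) = lc i , lc j , adjacent-distinct adj ∘ lc-injective ,
                                    λ Z (isPre , _ , _ , condL) → PL.adjacent-comparable {Z} isPre condL adj

mainTheorem8 : (m n : ℕ) → 1 ≤ m → 1 ≤ n →
    ((R : Rel m n) → IsGood R → (MeetIrreducible (just R) ⇔ TwoClasses R))
    × (2 ≤ (m ∸ 1) + (n ∸ 1) → ¬ MeetIrreducible {m} {n} nothing)
mainTheorem8 m n _ _ =
  (λ R good → mk⇔ (meetIrreducible⇒twoClasses good) (twoClasses⇒meetIrreducible good)) ,
  λ two → let (_ , _ , x≢y , comparable) = alwaysComparable-pair two
          in bottom-not-meetIrreducible x≢y comparable
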